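{- The wall $W$ has a $4$-track layout such that for all distinct edges $pq$ and $pr$ of $W$, the vertices $q$ and $r$ are in distinct tracks.
   Context: The wall is the infinite graph $W$ with vertex set $\mathbb{Z}^2$ and edge set $\{(x,y)(x+1,y): x,y\in\mathbb{Z}\}\cup\{(x,y)(x,y+1): x,y\in\mathbb{Z},\ x+y \text{ even}\}$. A track in a graph is an independent set equipped with a total order $\preceq$. A $k$-track layout is a partition $(V_1,\dots,V_k)$ of the vertex set into tracks such that there are no edges $vw$ and $xy$ with $v\prec x$ in some track $V_i$ and $y\prec w$ in some track $V_j$. -}

module Defs where

open import Data.Integer using (ℤ; _+_; +_)
open import Data.Integer.Divisibility using (_∣_)
open import Data.Product using (_×_; _,_)
open import Data.Sum using (_⊎_)
open import Data.Fin using (Fin)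
open import Data.Nat using (ℕ)
open import Data.Empty using (⊥)
open import Relation.Binary.PropositionalEquality using (_≡_; _≢_)
open import Relation.Nullary using (¬_)

V : Set
V = ℤ × ℤ

data Edge : V → V → Set where
  horiz : ∀ x y → Edge (x , y) (x + + 1 , y)
  vert  : ∀ x y → (+ 2) ∣ (x + y) → Edge (x , y) (x , y + + 1)

Adj : V → V → Set
Adj u v = Edge u v ⊎ Edge v u

record TrackLayout (k : ℕ) : Set₁ where
  field
    track : V → Fin k
    prec  : Fin k → V → V → Set
    prec-in     : ∀ i v w → prec i v w → (track v ≡ i) × (track w ≡ i)
    prec-irrefl : ∀ i v → ¬ prec i v v
    prec-trans  : ∀ i u v w → prec i u v → prec i v w → prec i u w
    prec-total  : ∀ i v w → track v ≡ i → track w ≡ i → v ≢ w →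
                  prec i v w ⊎ prec i w v
    independent : ∀ v w → Adj v w → track v ≢ track w
    no-X        : ∀ i j v w x y → Adj v w → Adj x y →
                  prec i v x → prec j y w → ⊥

-- Colour (x, y) by x + 2y mod 4 and order every colour class lexicographically.
-- A step right, left, up or down changes x + 2y by 1, -1, 2 or -2, so no two
-- adjacent vertices share a colour, and two edges vw, xy with v, x and w, y
-- equally coloured are translates of each other unless one goes up and the
-- other down. Translates never cross in a translation-invariant order. For an
-- up and a down edge, lexicographic order leaves room for a crossing only when
-- x is the upper end of vw, which would give v and w the same colour. Two
-- equally coloured neighbours of a vertex must be its upper and lower
-- neighbour, and the parity condition on vertical edges forbids having both.
module Submission where

open import Defs
open import Data.Empty using (⊥; ⊥-elim)
open import Data.Bool.Base using (T)
open import Data.Fin.Base using (Fin; toℕ; fromℕ<)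
open import Data.Fin.Properties using (toℕ-fromℕ<)
open import Data.Integer.Base using (ℤ; +_; -_; _+_; _-_; _*_; _<_; ∣_∣; 1ℤ; -1ℤ)
open import Data.Integer.DivMod using (_%ℕ_; _/ℕ_; n%ℕd<d; a≡a%ℕn+[a/ℕn]*n)
open import Data.Integer.Divisibility.Signed
  using (_∣_; divides; ∣ᵤ⇒∣; ∣⇒∣ᵤ; ∣m+n∣m⇒∣n; ∣m∣n⇒∣m-n)
import Data.Integer.Properties as ℤ
open import Data.Integer.Tactic.RingSolver using (solve-∀)
open import Data.Nat.Base as ℕ using (ℕ; _<ᵇ_)
open import Data.Nat.Divisibility using (>⇒∤)
open import Data.Nat.Properties using (<ᵇ⇒<)
open import Data.Product using (Σ; Σ-syntax; _×_; _,_; map)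
open import Data.Product.Relation.Binary.Lex.Strict using (×-Lex; ×-isStrictTotalOrder)
open import Data.Product.Relation.Binary.Pointwise.NonDependent using (Pointwise; ≡×≡⇒≡)
open import Data.Sum using (_⊎_; inj₁; inj₂)
open import Data.Unit using (⊤)
open import Function using (id)
open import Level using (0ℓ)
open import Relation.Binary using (Rel; _⇒_; _Preserves_⟶_; IsStrictTotalOrder; tri<; tri≈; tri>)
open import Relation.Binary.PropositionalEquality
  using (_≡_; _≢_; refl; sym; trans; cong; cong₂; subst; module ≡-Reasoning)
open import Relation.Nullary using (¬_)

private
  variable
    A B : Set
    v w x y p q r : V

module _ {k : ℕ} (colour : V → Fin k)
         {_≈_ _≺_ : Rel V 0ℓ} (order : IsStrictTotalOrder _≈_ _≺_) (≈⇒≡ : _≈_ ⇒ _≡_)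
         (proper : ∀ {v w} → Adj v w → colour v ≢ colour w)
         (no-crossing : ∀ {v w x y} → Adj v w → Adj x y →
                        colour v ≡ colour x → colour w ≡ colour y → v ≺ x → y ≺ w → ⊥)
         where

  open IsStrictTotalOrder order using (irrefl; compare; module Eq) renaming (trans to ≺-trans)

  ColourClassOrder : Fin k → V → V → Set
  ColourClassOrder i v w = colour v ≡ i × colour w ≡ i × v ≺ w

  ColourClassOrder-total : ∀ i v w → colour v ≡ i → colour w ≡ i → v ≢ w →
                           ColourClassOrder i v w ⊎ ColourClassOrder i w v
  ColourClassOrder-total _ v w cv cw v≢w with compare v w
  ... | tri< v≺w _ _ = inj₁ (cv , cw , v≺w)
  ... | tri≈ _ v≈w _ = ⊥-elim (v≢w (≈⇒≡ v≈w))
  ... | tri> _ _ w≺v = inj₂ (cw , cv , w≺v)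

  colourClassLayout : TrackLayout k
  colourClassLayout = record
    { track       = colour
    ; prec        = ColourClassOrder
    ; prec-in     = λ { _ _ _ (cv , cw , _) → cv , cw }
    ; prec-irrefl = λ { _ _ (_ , _ , v≺v) → irrefl Eq.refl v≺v }
    ; prec-trans  = λ { _ _ _ _ (cu , _ , u≺v) (_ , cw , v≺w) → cu , cw , ≺-trans u≺v v≺w }
    ; prec-total  = ColourClassOrder-total
    ; independent = λ _ _ → proper
    ; no-X        = λ { _ _ _ _ _ _ vw xy (cv , cx , v≺x) (cy , cw , y≺w) →
                        no-crossing vw xy (trans cv (sym cx)) (trans cw (sym cy)) v≺x y≺w }
    }

-- Opaque: unfolding residues during unification in the case analyses below
-- exhausts memory.
opaque
  _mod_ : ℤ → (n : ℕ) .{{_ : ℕ.NonZero n}} → Fin n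
  z mod n = fromℕ< (n%ℕd<d z n)

  mod-injective : ∀ {a b} (n : ℕ) .{{_ : ℕ.NonZero n}} → a mod n ≡ b mod n → + n ∣ a - b
  mod-injective {a} {b} n a≡b = divides (a /ℕ n - b /ℕ n) (begin
    a - b
      ≡⟨ cong₂ _-_ (a≡a%ℕn+[a/ℕn]*n a n) (a≡a%ℕn+[a/ℕn]*n b n) ⟩
    (+ (a %ℕ n) + a /ℕ n * + n) - (+ (b %ℕ n) + b /ℕ n * + n)
      ≡⟨ cancel-remainders (a /ℕ n) (b /ℕ n) (+ n) remainders-agree ⟩
    (a /ℕ n - b /ℕ n) * + n
      ∎)
    where
    open ≡-Reasoning
    remainders-agree : a %ℕ n ≡ b %ℕ n
    remainders-agree = trans (sym (toℕ-fromℕ< _)) (trans (cong toℕ a≡b) (toℕ-fromℕ< _))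
    identity : ∀ r i j m → (r + i * m) - (r + j * m) ≡ (i - j) * m
    identity = solve-∀
    cancel-remainders : ∀ {r s} i j m → r ≡ s → (+ r + i * m) - (+ s + j * m) ≡ (i - j) * m
    cancel-remainders {r} i j m refl = identity (+ r) i j m

∤-small : ∀ {m z} .{{_ : ℕ.NonZero ∣ z ∣}} → T (∣ z ∣ <ᵇ m) → ¬ (+ m ∣ z)
∤-small {m} {z} small m∣z = >⇒∤ (<ᵇ⇒< ∣ z ∣ m small) (∣⇒∣ᵤ m∣z)

×-Lex-map : ∀ {_<₁_ : Rel A 0ℓ} {_<₂_ : Rel B 0ℓ} {f : A → A} {g : B → B} →
            f Preserves _<₁_ ⟶ _<₁_ → g Preserves _<₂_ ⟶ _<₂_ →
            map f g Preserves ×-Lex _≡_ _<₁_ _<₂_ ⟶ ×-Lex _≡_ _<₁_ _<₂_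
×-Lex-map f-mono g-mono (inj₁ a<c)          = inj₁ (f-mono a<c)
×-Lex-map f-mono g-mono (inj₂ (refl , b<d)) = inj₂ (refl , g-mono b<d)

i<i+1 : ∀ i → i < i + 1ℤ
i<i+1 i = ℤ.suc[i]≤j⇒i<j (ℤ.≤-reflexive (ℤ.+-comm 1ℤ i))

i-1<i : ∀ i → i - 1ℤ < i
i-1<i i = ℤ.i≤pred[j]⇒i<j (ℤ.≤-reflexive (ℤ.+-comm i -1ℤ))

i+1-1≡i : ∀ i → (i + 1ℤ) - 1ℤ ≡ i
i+1-1≡i = solve-∀

i-1+1≡i : ∀ i → (i - 1ℤ) + 1ℤ ≡ i
i-1+1≡i = solve-∀

i+j-i≡j : ∀ i j → (i + j) - i ≡ j
i+j-i≡j = solve-∀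

_<ₗ_ : Rel V 0ℓ
_<ₗ_ = ×-Lex _≡_ _<_ _<_

<ₗ-isStrictTotalOrder : IsStrictTotalOrder (Pointwise _≡_ _≡_) _<ₗ_
<ₗ-isStrictTotalOrder = ×-isStrictTotalOrder ℤ.<-isStrictTotalOrder ℤ.<-isStrictTotalOrder

module <ₗ = IsStrictTotalOrder <ₗ-isStrictTotalOrder

data Dir : Set where
  right left up down : Dir

step : Dir → V → V
step right = map (_+ 1ℤ) id
step left  = map (_- 1ℤ) id
step up    = map id (_+ 1ℤ)
step down  = map id (_- 1ℤ)

step-mono : ∀ d → step d Preserves _<ₗ_ ⟶ _<ₗ_
step-mono right = ×-Lex-map {_<₁_ = _<_} {_<₂_ = _<_} (ℤ.+-monoˡ-< 1ℤ) id
step-mono left  = ×-Lex-map {_<₁_ = _<_} {_<₂_ = _<_} (ℤ.+-monoˡ-< -1ℤ) id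
step-mono up    = ×-Lex-map {_<₁_ = _<_} {_<₂_ = _<_} id (ℤ.+-monoˡ-< 1ℤ)
step-mono down  = ×-Lex-map {_<₁_ = _<_} {_<₂_ = _<_} id (ℤ.+-monoˡ-< -1ℤ)

<ₗ-step-up : ∀ v → v <ₗ step up v
<ₗ-step-up (a , b) = inj₂ (refl , i<i+1 b)

step-down-<ₗ : ∀ v → step down v <ₗ v
step-down-<ₗ (a , b) = inj₂ (refl , i-1<i b)

step-up-covers : ∀ {v x} → v <ₗ x → x <ₗ step up v → ⊥
step-up-covers         (inj₁ a<c)          (inj₁ c<a)         = ℤ.<-asym a<c c<a
step-up-covers         (inj₁ a<c)          (inj₂ (refl , _))  = ℤ.<-irrefl refl a<c
step-up-covers         (inj₂ (refl , _))   (inj₁ a<a)         = ℤ.<-irrefl refl a<a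
step-up-covers {_ , b} (inj₂ (refl , b<d)) (inj₂ (_ , d<b+1)) =
  ℤ.≤⇒≯ (ℤ.i<j⇒suc[i]≤j b<d) (subst (_ <_) (ℤ.+-comm b 1ℤ) d<b+1)

step-up-step-down : ∀ v → step up (step down v) ≡ v
step-up-step-down (a , b) = cong (a ,_) (i-1+1≡i b)

weight : V → ℤ
weight (x , y) = x + + 2 * y

colour : V → Fin 4
colour v = weight v mod 4

shift : Dir → ℤ
shift right = + 1
shift left  = -1ℤ
shift up    = + 2
shift down  = - + 2

weight-horizontal : ∀ x y s → weight (x + s , y) ≡ weight (x , y) + s
weight-horizontal = identity
  where
  identity : ∀ x y s → (x + s) + + 2 * y ≡ (x + + 2 * y) + s
  identity = solve-∀

weight-vertical : ∀ x y t → weight (x , y + t) ≡ weight (x , y) + + 2 * t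
weight-vertical = identity
  where
  identity : ∀ x y t → x + + 2 * (y + t) ≡ (x + + 2 * y) + + 2 * t
  identity = solve-∀

weight-step : ∀ d v → weight (step d v) ≡ weight v + shift d
weight-step right (x , y) = weight-horizontal x y 1ℤ
weight-step left  (x , y) = weight-horizontal x y -1ℤ
weight-step up    (x , y) = weight-vertical x y 1ℤ
weight-step down  (x , y) = weight-vertical x y -1ℤ

colour-≡⇒∣ : ∀ u v → colour u ≡ colour v → + 4 ∣ weight u - weight v
colour-≡⇒∣ u v = mod-injective {weight u} {weight v} 4

colour-step-≢ : ∀ d v → colour (step d v) ≢ colour v
colour-step-≢ d v c≡c = shift∤ d (subst (+ 4 ∣_) weight-difference (colour-≡⇒∣ (step d v) v c≡c))
  where
  open ≡-Reasoning
  weight-difference : weight (step d v) - weight v ≡ shift d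
  weight-difference = begin
    weight (step d v) - weight v    ≡⟨ cong (_- weight v) (weight-step d v) ⟩
    (weight v + shift d) - weight v ≡⟨ i+j-i≡j (weight v) (shift d) ⟩
    shift d                         ∎
  shift∤ : ∀ d → ¬ (+ 4 ∣ shift d)
  shift∤ right = ∤-small _
  shift∤ left  = ∤-small _
  shift∤ up    = ∤-small _
  shift∤ down  = ∤-small _

data SameShift : Dir → Dir → Set where
  same    : ∀ {d} → SameShift d d
  up-down : SameShift up down
  down-up : SameShift down up

∣shift-difference⇒SameShift : ∀ d e → + 4 ∣ shift d - shift e → SameShift d e
∣shift-difference⇒SameShift right right _  = same
∣shift-difference⇒SameShift right left  4∣ = ⊥-elim (∤-small _ 4∣)
∣shift-difference⇒SameShift right up    4∣ = ⊥-elim (∤-small _ 4∣)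
∣shift-difference⇒SameShift right down  4∣ = ⊥-elim (∤-small _ 4∣)
∣shift-difference⇒SameShift left  right 4∣ = ⊥-elim (∤-small _ 4∣)
∣shift-difference⇒SameShift left  left  _  = same
∣shift-difference⇒SameShift left  up    4∣ = ⊥-elim (∤-small _ 4∣)
∣shift-difference⇒SameShift left  down  4∣ = ⊥-elim (∤-small _ 4∣)
∣shift-difference⇒SameShift up    right 4∣ = ⊥-elim (∤-small _ 4∣)
∣shift-difference⇒SameShift up    left  4∣ = ⊥-elim (∤-small _ 4∣)
∣shift-difference⇒SameShift up    up    _  = same
∣shift-difference⇒SameShift up    down  _  = up-down
∣shift-difference⇒SameShift down  right 4∣ = ⊥-elim (∤-small _ 4∣)
∣shift-difference⇒SameShift down  left  4∣ = ⊥-elim (∤-small _ 4∣)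
∣shift-difference⇒SameShift down  up    _  = down-up
∣shift-difference⇒SameShift down  down  _  = same

colour-steps⇒SameShift : ∀ d e v x → colour v ≡ colour x → colour (step d v) ≡ colour (step e x) →
                         SameShift d e
colour-steps⇒SameShift d e v x cv≡cx cw≡cy =
  ∣shift-difference⇒SameShift d e (∣m+n∣m⇒∣n 4∣steps-difference (colour-≡⇒∣ v x cv≡cx))
  where
  open ≡-Reasoning
  rearrange : ∀ a b s t → (a + s) - (b + t) ≡ (a - b) + (s - t)
  rearrange = solve-∀
  weight-difference : weight (step d v) - weight (step e x) ≡ (weight v - weight x) + (shift d - shift e)
  weight-difference = begin
    weight (step d v) - weight (step e x)         ≡⟨ cong₂ _-_ (weight-step d v) (weight-step e x) ⟩
    (weight v + shift d) - (weight x + shift e)   ≡⟨ rearrange (weight v) (weight x) (shift d) (shift e) ⟩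
    (weight v - weight x) + (shift d - shift e)   ∎
  4∣steps-difference : + 4 ∣ (weight v - weight x) + (shift d - shift e)
  4∣steps-difference = subst (+ 4 ∣_) weight-difference (colour-≡⇒∣ (step d v) (step e x) cw≡cy)

Passable : Dir → V → Set
Passable right _       = ⊤
Passable left  _       = ⊤
Passable up    (x , y) = + 2 ∣ x + y
Passable down  (x , y) = + 2 ∣ (x + y) - 1ℤ

adj⇒step : Adj v w → Σ[ d ∈ Dir ] Passable d v × w ≡ step d v
adj⇒step (inj₁ (horiz x y))    = right , _ , refl
adj⇒step (inj₁ (vert x y 2∣))  = up , ∣ᵤ⇒∣ 2∣ , refl
adj⇒step (inj₂ (horiz x y))    = left , _ , cong (_, y) (sym (i+1-1≡i x))
adj⇒step (inj₂ (vert x y 2∣))  = down , subst (+ 2 ∣_) (parity x y) (∣ᵤ⇒∣ 2∣) , cong (x ,_) (sym (i+1-1≡i y))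
  where
  parity : ∀ x y → x + y ≡ (x + (y + 1ℤ)) - 1ℤ
  parity = solve-∀

¬up∧down : ∀ v → Passable up v → Passable down v → ⊥
¬up∧down (x , y) 2∣s 2∣s-1 = ∤-small _ (subst (+ 2 ∣_) (difference (x + y)) (∣m∣n⇒∣m-n 2∣s 2∣s-1))
  where
  difference : ∀ s → s - (s - 1ℤ) ≡ 1ℤ
  difference = solve-∀

wall-proper : Adj v w → colour v ≢ colour w
wall-proper {v} vw with adj⇒step vw
... | d , _ , refl = λ cv≡cw → colour-step-≢ d v (sym cv≡cw)

wall-no-crossing : Adj v w → Adj x y → colour v ≡ colour x → colour w ≡ colour y →
                   v <ₗ x → y <ₗ w → ⊥
wall-no-crossing {v} {w} {x} {y} vw xy cv≡cx cw≡cy v<x y<w with adj⇒step vw | adj⇒step xy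
... | d , _ , refl | e , _ , refl with colour-steps⇒SameShift d e v x cv≡cx cw≡cy
...   | same    = <ₗ.asym (step-mono d v<x) y<w
...   | down-up = <ₗ.irrefl (refl , refl)
                    (<ₗ.trans v<x (<ₗ.trans (<ₗ-step-up x) (<ₗ.trans y<w (step-down-<ₗ v))))
...   | up-down with <ₗ.compare x w
...     | tri< x<w _ _ = step-up-covers v<x x<w
...     | tri≈ _ x≈w _ = wall-proper vw (trans cv≡cx (cong colour (≡×≡⇒≡ x≈w)))
...     | tri> _ _ w<x = step-up-covers w<x (subst (_<ₗ step up w) (step-up-step-down x) (step-mono up y<w))

wall-neighbours-differ : Adj p q → Adj p r → q ≢ r → colour q ≢ colour r
wall-neighbours-differ {p} pq pr q≢r cq≡cr with adj⇒step pq | adj⇒step pr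
... | d , pd , refl | e , pe , refl with colour-steps⇒SameShift d e p p refl cq≡cr
...   | same    = q≢r refl
...   | up-down = ¬up∧down p pd pe
...   | down-up = ¬up∧down p pe pd

lemma13 : Σ (TrackLayout 4) (λ L →
            ∀ p q r → Adj p q → Adj p r → q ≢ r →
              TrackLayout.track L q ≢ TrackLayout.track L r)
lemma13 = colourClassLayout colour <ₗ-isStrictTotalOrder ≡×≡⇒≡ wall-proper wall-no-crossing
        , λ _ _ _ → wall-neighbours-differ
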